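{- Let $G=(V,E)$ be a finite connected graph with $E\neq\emptyset$. A subgraph $S\subseteq G$ is a segmentation of $G$ if and only if (i) the graph induced by $E(S)$ is $S$; (ii) $S$ is spanning for $V$, i.e. $V(S)=V$; and (iii) every connected component $X$ of $S$ satisfies $X=\phi(X)$.
   Context: Graphs are finite and simple. For $S\subseteq E$, the graph induced by $S$ is $(\{x\in V:\exists u\in S, x\in u\},S)$; $\bar S=E\setminus S$. A set $C\subseteq E$ is a cut of $G$ if for each edge $\{x,y\}\in C$, $x$ and $y$ lie in two different nonempty connected components of the graph induced by $\bar C$. A subgraph $S$ of $G$ is a segmentation of $G$ if $\overline{E(S)}$ is a cut. For a subgraph $X$ of $G$, the edge-closing is $\phi(X)=(V(X),\{\{x,y\}\in E: x\in V(X), y\in V(X)\})$. -}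

module Defs where

open import Data.Nat using (ℕ)
open import Data.Fin using (Fin)
open import Data.Bool using (Bool; true; false; _∧_; not)
open import Data.Bool.Properties using (∧-comm)
open import Data.Product using (Σ; ∃; ∃-syntax; _×_; _,_; proj₁; proj₂)
open import Relation.Nullary using (¬_)
open import Relation.Binary.PropositionalEquality using (_≡_; refl; cong₂; sym; trans)
open import Function.Bundles using (_⇔_)

record Graph (n : ℕ) : Set where
  field
    adj     : Fin n → Fin n → Bool
    adj-sym : ∀ x y → adj x y ≡ adj y x
    irrefl  : ∀ x → adj x x ≡ false
open Graph public

EdgeSet : ℕ → Set
EdgeSet n = Fin n → Fin n → Bool

VertSet : ℕ → Set
VertSet n = Fin n → Bool

data Reach {n : ℕ} (R : EdgeSet n) : Fin n → Fin n → Set where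
  here : ∀ {x} → Reach R x x
  step : ∀ {x y z} → R x y ≡ true → Reach R y z → Reach R x z

Connected : ∀ {n} → Graph n → Set
Connected G = ∀ x y → Reach (adj G) x y

HasEdge : ∀ {n} → Graph n → Set
HasEdge G = ∃[ x ] ∃[ y ] adj G x y ≡ true

record Subgraph {n : ℕ} (G : Graph n) : Set where
  field
    vert      : VertSet n
    edge      : EdgeSet n
    edge-sym  : ∀ x y → edge x y ≡ edge y x
    edge-sub  : ∀ x y → edge x y ≡ true → adj G x y ≡ true
    edge-vert : ∀ x y → edge x y ≡ true → vert x ≡ true
open Subgraph public

_≈S_ : ∀ {n} {G : Graph n} → Subgraph G → Subgraph G → Set
S ≈S T = (∀ x → vert S x ≡ vert T x) × (∀ x y → edge S x y ≡ edge T x y)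

InducedVert : ∀ {n} → EdgeSet n → Fin n → Set
InducedVert F x = ∃[ y ] F x y ≡ true

compl : ∀ {n} → Graph n → EdgeSet n → EdgeSet n
compl G C x y = adj G x y ∧ not (C x y)

IsCut : ∀ {n} → Graph n → EdgeSet n → Set
IsCut G C =
  (∀ x y → C x y ≡ true → adj G x y ≡ true) ×
  (∀ x y → C x y ≡ true →
     InducedVert (compl G C) x × InducedVert (compl G C) y × ¬ Reach (compl G C) x y)

IsSegmentation : ∀ {n} (G : Graph n) → Subgraph G → Set
IsSegmentation G S = IsCut G (compl G (edge S))

IsComponent : ∀ {n} {G : Graph n} → Subgraph G → Subgraph G → Set
IsComponent S X =
  (∃[ x ] vert X x ≡ true) ×
  (∀ x → vert X x ≡ true → vert S x ≡ true) ×
  (∀ x y → vert X x ≡ true → vert X y ≡ true → Reach (edge S) x y) ×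
  (∀ x y → vert X x ≡ true → edge S x y ≡ true → vert X y ≡ true) ×
  (∀ x y → edge X x y ≡ (edge S x y ∧ (vert X x ∧ vert X y)))

private
  ∧-true₁ : ∀ a b → (a ∧ b) ≡ true → a ≡ true
  ∧-true₁ true b p = refl

  ∧-true₂ : ∀ a b → (a ∧ b) ≡ true → b ≡ true
  ∧-true₂ true b p = p

φ : ∀ {n} {G : Graph n} → Subgraph G → Subgraph G
φ {G = G} X = record
  { vert      = vert X
  ; edge      = λ x y → adj G x y ∧ (vert X x ∧ vert X y)
  ; edge-sym  = λ x y → cong₂ _∧_ (adj-sym G x y) (∧-comm (vert X x) (vert X y))
  ; edge-sub  = λ x y p → ∧-true₁ (adj G x y) _ p
  ; edge-vert = λ x y p → ∧-true₁ (vert X x) _ (∧-true₂ (adj G x y) _ p)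
  }

-- The graph induced by E(S) equals S (as vertex sets: V(S) = {x | ∃ e ∈ E(S), x ∈ e};
-- the edge sets agree trivially).
InducedByEdges : ∀ {n} {G : Graph n} → Subgraph G → Set
InducedByEdges S = ∀ x → (vert S x ≡ true ⇔ InducedVert (edge S) x)

Spanning : ∀ {n} {G : Graph n} → Subgraph G → Set
Spanning S = ∀ x → vert S x ≡ true

-- Write C for the complement of E(S) in E. As E(S) ⊆ E, the complement of C is E(S) again, so S
-- is a segmentation iff every edge of G outside S joins two vertices that both lie on S-edges and
-- are not connected in S. In a connected graph with an edge every vertex lies on a G-edge, and the
-- cut condition then puts it on an S-edge: this is (i) together with (ii). The separation part says
-- that S contains every G-edge between two S-connected vertices, which is exactly X = φ(X) for each
-- component X of S. For the converse the component of a vertex is needed as a concrete vertex set;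
-- it is the reachability closure, computed by adding escaping vertices until none is left.
module Submission where

open import Defs
open import Data.Nat using (ℕ)
open import Data.Fin using (Fin)
open import Data.Fin.Properties using (any?)
open import Data.Fin.Subset using (Subset; _∈_; _∉_; _⊃_; _∪_; ⁅_⁆)
open import Data.Fin.Subset.Properties using (_∈?_; x∈⁅x⁆; x∈⁅y⁆⇒x≡y; p⊆p∪q; q⊆p∪q; x∈p∪q⁻)
open import Data.Fin.Subset.Induction using (Acc; acc; ⊃-wellFounded)
open import Data.Vec using (lookup)
open import Data.Vec.Properties using ([]=⇒lookup; lookup⇒[]=)
open import Data.Bool using (true; false; _∧_; not)
open import Data.Bool.Properties using (∧-comm; ∧-identityʳ; ∧-inverseʳ; ∧-zeroʳ) renaming (_≟_ to _≟ᵇ_)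
open import Data.Product using (∃₂; ∃-syntax; _×_; _,_; proj₁; proj₂)
open import Data.Sum using (inj₁; inj₂)
open import Relation.Nullary using (¬_; Dec; yes; no; contradiction; ¬?; _×-dec_)
open import Relation.Binary.PropositionalEquality using (_≡_; refl; sym; trans; cong; cong₂; module ≡-Reasoning)
open import Function.Bundles using (_⇔_; mk⇔; Equivalence)

∧-true⁻ : ∀ a b → a ∧ b ≡ true → a ≡ true × b ≡ true
∧-true⁻ true true _ = refl , refl

∧-not-true⁻ : ∀ a b → a ∧ not b ≡ true → a ≡ true × b ≡ false
∧-not-true⁻ true false _ = refl , refl

∧-congʳ-if : ∀ {a b} c → (c ≡ true → a ≡ b) → a ∧ c ≡ b ∧ c
∧-congʳ-if {a} {b} true  a≡b = trans (∧-identityʳ a) (trans (a≡b refl) (sym (∧-identityʳ b)))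
∧-congʳ-if {a} {b} false _   = trans (∧-zeroʳ a) (sym (∧-zeroʳ b))

module _ {n : ℕ} {R : EdgeSet n} where

  reach-snoc : ∀ {x y z} → Reach R x y → R y z ≡ true → Reach R x z
  reach-snoc here       r = step r here
  reach-snoc (step r p) s = step r (reach-snoc p s)

  reach-trans : ∀ {x y z} → Reach R x y → Reach R y z → Reach R x z
  reach-trans here       q = q
  reach-trans (step r p) q = step r (reach-trans p q)

  reach-sym : (∀ x y → R x y ≡ R y x) → ∀ {x y} → Reach R x y → Reach R y x
  reach-sym R-sym here               = here
  reach-sym R-sym (step {x} {y} r p) = reach-snoc (reach-sym R-sym p) (trans (R-sym y x) r)

  reach-map : ∀ {R′ : EdgeSet n} → (∀ x y → R x y ≡ true → R′ x y ≡ true) →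
              ∀ {x y} → Reach R x y → Reach R′ x y
  reach-map f here       = here
  reach-map f (step r p) = step (f _ _ r) (reach-map f p)

module _ {n : ℕ} (R : EdgeSet n) where

  Closed : Subset n → Set
  Closed p = ∀ {w z} → w ∈ p → R w z ≡ true → z ∈ p

  Escape : Subset n → Set
  Escape p = ∃₂ λ w z → w ∈ p × z ∉ p × R w z ≡ true

  escape? : ∀ p → Dec (Escape p)
  escape? p = any? λ w → any? λ z → w ∈? p ×-dec ¬? (z ∈? p) ×-dec R w z ≟ᵇ true

  ¬escape⇒closed : ∀ {p} → ¬ Escape p → Closed p
  ¬escape⇒closed {p} none {w} {z} w∈p r with z ∈? p
  ... | yes z∈p = z∈p
  ... | no  z∉p = contradiction (w , z , w∈p , z∉p , r) none

  closed-reach : ∀ {p x z} → Closed p → x ∈ p → Reach R x z → z ∈ p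
  closed-reach closed x∈p here       = x∈p
  closed-reach closed x∈p (step r p) = closed-reach closed (closed x∈p r) p

  ReachClosure : Fin n → Subset n → Set
  ReachClosure x p = x ∈ p × (∀ {z} → z ∈ p → Reach R x z) × Closed p

  grow : ∀ {x} p → Acc _⊃_ p → x ∈ p → (∀ {z} → z ∈ p → Reach R x z) → ∃[ q ] ReachClosure x q
  grow {x} p (acc smaller) x∈p p-reach with escape? p
  ... | no  none = p , x∈p , p-reach , ¬escape⇒closed none
  ... | yes (w , z , w∈p , z∉p , r) =
    grow (p ∪ ⁅ z ⁆) (smaller p∪z⊃p) (p⊆p∪q ⁅ z ⁆ x∈p) p∪z-reach
    where
      p∪z⊃p : (p ∪ ⁅ z ⁆) ⊃ p
      p∪z⊃p = p⊆p∪q ⁅ z ⁆ , z , q⊆p∪q p ⁅ z ⁆ (x∈⁅x⁆ z) , z∉p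

      p∪z-reach : ∀ {y} → y ∈ p ∪ ⁅ z ⁆ → Reach R x y
      p∪z-reach y∈ with x∈p∪q⁻ p ⁅ z ⁆ y∈
      ... | inj₁ y∈p = p-reach y∈p
      ... | inj₂ y∈z rewrite x∈⁅y⁆⇒x≡y z y∈z = reach-snoc (p-reach w∈p) r

  reachClosure : ∀ x → ∃[ q ] ReachClosure x q
  reachClosure x = grow ⁅ x ⁆ (⊃-wellFounded ⁅ x ⁆) (x∈⁅x⁆ x) λ z∈x → reach-of-≡ (x∈⁅y⁆⇒x≡y x z∈x)
    where
      reach-of-≡ : ∀ {z} → z ≡ x → Reach R x z
      reach-of-≡ refl = here

  reachable : Fin n → VertSet n
  reachable x = lookup (proj₁ (reachClosure x))

  reachable-sound : ∀ {x z} → reachable x z ≡ true → Reach R x z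
  reachable-sound {x} {z} m = proj₁ (proj₂ (proj₂ (reachClosure x))) (lookup⇒[]= z _ m)

  reachable-complete : ∀ {x z} → Reach R x z → reachable x z ≡ true
  reachable-complete {x} r =
    let _ , x∈q , _ , closed = reachClosure x in []=⇒lookup (closed-reach closed x∈q r)

module _ {n : ℕ} {G : Graph n} where

  EdgeCover : Subgraph G → Set
  EdgeCover S = ∀ x → InducedVert (edge S) x

  Saturated : Subgraph G → Set
  Saturated S = ∀ x y → adj G x y ≡ true → Reach (edge S) x y → edge S x y ≡ true

  connected⇒neighbour : Connected G → HasEdge G → ∀ x → ∃[ y ] adj G x y ≡ true
  connected⇒neighbour conn (a , b , adj-ab) x with conn x a
  ... | here           = b , adj-ab
  ... | step adj-xy _ = _ , adj-xy

  compl-true⁺ : ∀ (F : EdgeSet n) {x y} → adj G x y ≡ true → F x y ≡ false → compl G F x y ≡ true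
  compl-true⁺ F adj-xy Fxy rewrite adj-xy | Fxy = refl

  compl-true⁻ : ∀ (F : EdgeSet n) x y → compl G F x y ≡ true → adj G x y ≡ true × F x y ≡ false
  compl-true⁻ F x y = ∧-not-true⁻ (adj G x y) (F x y)

  restrict : Subgraph G → VertSet n → Subgraph G
  restrict S p = record
    { vert      = p
    ; edge      = λ x y → edge S x y ∧ (p x ∧ p y)
    ; edge-sym  = λ x y → cong₂ _∧_ (edge-sym S x y) (∧-comm (p x) (p y))
    ; edge-sub  = λ x y e → edge-sub S x y (proj₁ (∧-true⁻ (edge S x y) _ e))
    ; edge-vert = λ x y e → proj₁ (∧-true⁻ (p x) _ (proj₂ (∧-true⁻ (edge S x y) _ e)))
    }

  module _ (S : Subgraph G) where

    edgeCover⇒inducedByEdges : EdgeCover S → InducedByEdges S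
    edgeCover⇒inducedByEdges cover x = mk⇔ (λ _ → cover x) (λ (z , e) → edge-vert S x z e)

    edgeCover⇒spanning : EdgeCover S → Spanning S
    edgeCover⇒spanning cover x = edge-vert S x _ (proj₂ (cover x))

    inducedByEdges×spanning⇒edgeCover : InducedByEdges S → Spanning S → EdgeCover S
    inducedByEdges×spanning⇒edgeCover ind span x = Equivalence.to (ind x) (span x)

    edge-adj-false : ∀ {x y} → adj G x y ≡ false → edge S x y ≡ false
    edge-adj-false {x} {y} adj-xy with edge S x y in exy
    ... | false = refl
    ... | true  = contradiction (trans (sym adj-xy) (edge-sub S x y exy)) λ ()

    reach-vert : ∀ {x z} → vert S x ≡ true → Reach (edge S) x z → vert S z ≡ true
    reach-vert vx here                   = vx
    reach-vert vx (step {x} {y} exy p) = reach-vert (edge-vert S y x (trans (edge-sym S y x) exy)) p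

    component : Fin n → Subgraph G
    component x = restrict S (reachable (edge S) x)

    component-isComponent : ∀ {x} → vert S x ≡ true → IsComponent S (component x)
    component-isComponent {x} vx =
      (x , complete here) ,
      (λ z m → reach-vert vx (sound m)) ,
      (λ a b ma mb → reach-trans (reach-sym (edge-sym S) (sound ma)) (sound mb)) ,
      (λ a b ma e → complete (reach-snoc (sound ma) e)) ,
      (λ a b → refl)
      where
        sound : ∀ {z} → reachable (edge S) x z ≡ true → Reach (edge S) x z
        sound = reachable-sound (edge S)

        complete : ∀ {z} → Reach (edge S) x z → reachable (edge S) x z ≡ true
        complete = reachable-complete (edge S)

    saturated-edge≡adj : Saturated S → ∀ {x y} → Reach (edge S) x y → edge S x y ≡ adj G x y
    saturated-edge≡adj sat {x} {y} r with adj G x y in adj-xy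
    ... | true  = sat x y adj-xy r
    ... | false = edge-adj-false adj-xy

    saturated⇒componentsClosed : Saturated S → ∀ X → IsComponent S X → X ≈S φ X
    saturated⇒componentsClosed sat X (_ , _ , X-connected , _ , edge-X) =
      (λ _ → refl) ,
      λ x y → trans (edge-X x y) (∧-congʳ-if (vert X x ∧ vert X y) λ vxy →
        let vx , vy = ∧-true⁻ (vert X x) _ vxy in saturated-edge≡adj sat (X-connected x y vx vy))

    -- A path between adjacent vertices has an edge, as G has no loops; its first edge puts x into S.
    componentsClosed⇒saturated : (∀ X → IsComponent S X → X ≈S φ X) → Saturated S
    componentsClosed⇒saturated X≈φX x x adj-xx here =
      contradiction (trans (sym adj-xx) (irrefl G x)) λ ()
    componentsClosed⇒saturated X≈φX x y adj-xy r@(step exz _) = begin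
      edge S x y                  ≡⟨ sym (∧-identityʳ _) ⟩
      edge S x y ∧ true           ≡⟨ cong (edge S x y ∧_) (sym vxy) ⟩
      edge X x y                  ≡⟨ proj₂ (X≈φX X (component-isComponent (edge-vert S x _ exz))) x y ⟩
      adj G x y ∧ (vert X x ∧ vert X y) ≡⟨ cong (adj G x y ∧_) vxy ⟩
      adj G x y ∧ true            ≡⟨ ∧-identityʳ _ ⟩
      adj G x y                   ≡⟨ adj-xy ⟩
      true                        ∎
      where
        open ≡-Reasoning
        X : Subgraph G
        X = component x

        vxy : vert X x ∧ vert X y ≡ true
        vxy = cong₂ _∧_ (reachable-complete (edge S) here) (reachable-complete (edge S) r)

    compl-compl : ∀ x y → compl G (compl G (edge S)) x y ≡ edge S x y
    compl-compl x y with edge S x y in exy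
    ... | true  rewrite edge-sub S x y exy = refl
    ... | false rewrite ∧-identityʳ (adj G x y) = ∧-inverseʳ (adj G x y)

    private
      C̄⇒edge : ∀ x y → compl G (compl G (edge S)) x y ≡ true → edge S x y ≡ true
      C̄⇒edge x y = trans (sym (compl-compl x y))

      edge⇒C̄ : ∀ x y → edge S x y ≡ true → compl G (compl G (edge S)) x y ≡ true
      edge⇒C̄ x y = trans (compl-compl x y)

    segmentation⇒edgeCover : Connected G → HasEdge G → IsSegmentation G S → EdgeCover S
    segmentation⇒edgeCover conn he (_ , cut) x with connected⇒neighbour conn he x
    ... | y , adj-xy with edge S x y in exy
    ...   | true  = y , exy
    ...   | false = let z , e = proj₁ (cut x y (compl-true⁺ (edge S) adj-xy exy)) in z , C̄⇒edge x z e

    segmentation⇒saturated : IsSegmentation G S → Saturated S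
    segmentation⇒saturated (_ , cut) x y adj-xy r with edge S x y in exy
    ... | true  = refl
    ... | false = contradiction (reach-map edge⇒C̄ r) (proj₂ (proj₂ (cut x y (compl-true⁺ (edge S) adj-xy exy))))

    edgeCover×saturated⇒segmentation : EdgeCover S → Saturated S → IsSegmentation G S
    edgeCover×saturated⇒segmentation cover sat =
      (λ x y c → proj₁ (compl-true⁻ (edge S) x y c)) ,
      λ x y c → let adj-xy , exy = compl-true⁻ (edge S) x y c in
        on-C̄ (cover x) , on-C̄ (cover y) ,
        λ r → contradiction (trans (sym exy) (sat x y adj-xy (reach-map C̄⇒edge r))) λ ()
      where
        on-C̄ : ∀ {x} → InducedVert (edge S) x → InducedVert (compl G (compl G (edge S))) x
        on-C̄ (z , e) = z , edge⇒C̄ _ z e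

mainTheorem3 : ∀ {n : ℕ} (G : Graph n) → Connected G → HasEdge G →
    (S : Subgraph G) →
    IsSegmentation G S ⇔
      (InducedByEdges S × Spanning S × (∀ (X : Subgraph G) → IsComponent S X → X ≈S φ X))
mainTheorem3 G conn he S = mk⇔
  (λ seg → let cover = segmentation⇒edgeCover S conn he seg in
    edgeCover⇒inducedByEdges S cover ,
    edgeCover⇒spanning S cover ,
    saturated⇒componentsClosed S (segmentation⇒saturated S seg))
  (λ (ind , span , X≈φX) →
    edgeCover×saturated⇒segmentation S
      (inducedByEdges×spanning⇒edgeCover S ind span)
      (componentsClosed⇒saturated S X≈φX))
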